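{- Let $m$ be an even positive integer, written as $m=2^k n$ with $n$ odd and $k\ge 1$, and let $M=\{a_1,\dots,a_m\}$ be a multiset of $m$ elements of $\mathbb{Z}_m$. (i) If all elements of $M$ have the same odd residue $c$ modulo $2^k$, then there is no permutation $\pi\in S_m$ with $\sum_{i=1}^m i a_{\pi(i)}=0$ in $\mathbb{Z}_m$. (ii) If $M=\{a,a,\dots,a,a+b,a-b\}$ (with $m-2$ copies of $a$) in $\mathbb{Z}_m$, where $a$ is even and $\gcd(b,m)=1$, then there is no permutation $\pi\in S_m$ with $\sum_{i=1}^m i a_{\pi(i)}=0$ in $\mathbb{Z}_m$.
   Context: Since $m$ is even, the parity of an element of $\mathbb{Z}_m$ and its residue modulo any divisor of $m$ are well defined. Multisets as in (i) are called homogeneous exceptional multisets, those as in (ii) inhomogeneous exceptional multisets. -}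

module Defs where

open import Data.Nat using (ℕ; zero; suc; _+_; _*_; _∸_; _<_; _^_; NonZero)
open import Data.Nat.Properties using (m^n≢0)
open import Data.Nat.DivMod using (_mod_; _%_)
open import Data.Nat.Divisibility using (_∣_)
open import Data.Fin using (Fin; toℕ)
open import Data.Fin.Permutation using (Permutation′; _⟨$⟩ʳ_)
open import Data.List using (map; allFin)
open import Data.Nat.ListAction using (sum)
open import Data.Product using (Σ-syntax)
open import Relation.Binary.PropositionalEquality using (_≡_)
open import Relation.Nullary using (¬_)

ℤ/ : ℕ → Set
ℤ/ m = Fin m

Even : ℕ → Set
Even x = 2 ∣ x

Odd : ℕ → Set
Odd x = ¬ (2 ∣ x)

addZ : ∀ m .{{_ : NonZero m}} → ℤ/ m → ℤ/ m → ℤ/ m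
addZ m x y = (toℕ x + toℕ y) mod m

subZ : ∀ m .{{_ : NonZero m}} → ℤ/ m → ℤ/ m → ℤ/ m
subZ m x y = (toℕ x + (m ∸ toℕ y)) mod m

-- A multiset of m elements of Z_m is given by a listing a : Fin m → ℤ/ m,
-- where index i : Fin m stands for a_{i+1}.
-- weightedSum a π = Σ_{i=1}^m i · a_{π(i)}  computed in Z_m.
weightedSum : ∀ m .{{_ : NonZero m}} → (Fin m → ℤ/ m) → Permutation′ m → ℤ/ m
weightedSum m a π = sum (map (λ i → suc (toℕ i) * toℕ (a (π ⟨$⟩ʳ i))) (allFin m)) mod m

SameMultiset : ∀ m → (Fin m → ℤ/ m) → (Fin m → ℤ/ m) → Set
SameMultiset m a g = Σ[ σ ∈ Permutation′ m ] (∀ i → a (σ ⟨$⟩ʳ i) ≡ g i)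

inhomList : ∀ m .{{_ : NonZero m}} → ℤ/ m → ℤ/ m → Fin m → ℤ/ m
inhomList m a b i with toℕ i Data.Nat.≟ (m ∸ 2) | toℕ i Data.Nat.≟ (m ∸ 1)
... | Relation.Nullary.yes _ | _ = addZ m a b
... | Relation.Nullary.no _ | Relation.Nullary.yes _ = subZ m a b
... | Relation.Nullary.no _ | Relation.Nullary.no _ = a

mod2^ : ℕ → ℕ → ℕ
mod2^ x k = _%_ x (2 ^ k) {{m^n≢0 2 k}}

zeroZ : ∀ m .{{_ : NonZero m}} → ℤ/ m
zeroZ m = 0 mod m

-- Both parts reduce the weighted sum modulo a divisor of m.  In (i), modulo 2^k
-- every a_i is congruent to c, so Σ i·a_π(i) ≡ c·m(m+1)/2 = 2^(k-1)·n(m+1)c, and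
-- n(m+1)c is odd.  In (ii), modulo m the sum is a·m(m+1)/2 + P·b + Q·(m − b), where
-- P and Q are the (1-based) positions at which a+b and a−b land; a even kills the
-- first term, so m ∣ (P − Q)·b, and gcd(b, m) = 1 forces m ∣ P − Q with
-- 0 < |P − Q| < m.

module Submission where

open import Defs
import Algebra.Properties.Semiring.Sum as Semiring
open import Data.Nat using (ℕ; zero; suc; _+_; _*_; _∸_; _^_; _≤_; _<_; z≤n; s≤s; NonZero; >-nonZero; _≟_)
open import Data.Nat.Properties
open import Data.Nat.DivMod using (_%_; _mod_; m%n<n; %-distribˡ-+; %-distribˡ-*; m%n%n≡m%n; m*n%n≡0)
open import Data.Nat.Divisibility
open import Data.Nat.Coprimality using (Coprime; gcd≡1⇒coprime; coprime-divisor)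
import Data.Nat.Coprimality as Coprimality
open import Data.Nat.GCD using (gcd)
open import Data.Nat.Primality using (euclidsLemma; prime[2])
open import Data.Nat.ListAction using (sum)
open import Data.Nat.Tactic.RingSolver using (solve-∀)
open import Data.List using (map; allFin; tabulate)
open import Data.List.Properties using (map-tabulate; map-cong)
open import Data.Fin as Fin using (Fin; zero; suc; toℕ; fromℕ; inject₁)
open import Data.Fin.Properties using (toℕ-fromℕ; toℕ-inject₁; toℕ-fromℕ<; toℕ<n; toℕ-injective)
open import Data.Fin.Permutation using (Permutation′; _⟨$⟩ʳ_; _⟨$⟩ˡ_; inverseˡ; inverseʳ; flip; _∘ₚ_)
open import Data.Product using (_×_; _,_; Σ-syntax)
open import Data.Sum using (inj₁; inj₂)
open import Function using (id; _∘_)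
open import Relation.Binary using (tri<; tri≈; tri>)
open import Relation.Binary.PropositionalEquality
open import Relation.Nullary using (¬_; yes; no; contradiction)

open Semiring +-*-semiring using (sum-syntax; ∑-distrib-+; *-distribʳ-sum; sum-replicate-zero)

sum-tabulate : ∀ n (F : Fin n → ℕ) → sum (tabulate F) ≡ ∑[ i < n ] F i
sum-tabulate zero F = refl
sum-tabulate (suc n) F = cong (F zero +_) (sum-tabulate n (λ i → F (suc i)))

sum-map-allFin : ∀ n (F : Fin n → ℕ) → sum (map F (allFin n)) ≡ ∑[ i < n ] F i
sum-map-allFin n F = trans (cong sum (map-tabulate id F)) (sum-tabulate n F)

∑-suc : ∀ n (f : Fin n → ℕ) → ∑[ i < n ] suc (f i) ≡ n + ∑[ i < n ] f i
∑-suc zero f = refl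
∑-suc (suc n) f = cong suc (begin
  f zero + ∑[ i < n ] suc (f (suc i))      ≡⟨ cong (f zero +_) (∑-suc n (λ i → f (suc i))) ⟩
  f zero + (n + ∑[ i < n ] f (suc i))      ≡⟨ +-comm-left (f zero) n _ ⟩
  n + (f zero + ∑[ i < n ] f (suc i))      ∎)
  where
  open ≡-Reasoning
  +-comm-left : ∀ u v w → u + (v + w) ≡ v + (u + w)
  +-comm-left = solve-∀

triangular : ℕ → ℕ
triangular n = ∑[ i < n ] suc (toℕ i)

triangular*2 : ∀ n → triangular n * 2 ≡ n * suc n
triangular*2 zero = refl
triangular*2 (suc n) = begin
  suc (∑[ i < n ] suc (suc (toℕ i))) * 2  ≡⟨ cong (λ s → suc s * 2) (∑-suc n (λ i → suc (toℕ i))) ⟩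
  suc (n + triangular n) * 2              ≡⟨ expand n (triangular n) ⟩
  2 * suc n + triangular n * 2            ≡⟨ cong (2 * suc n +_) (triangular*2 n) ⟩
  2 * suc n + n * suc n                   ≡⟨ factor n ⟩
  suc n * suc (suc n)                     ∎
  where
  open ≡-Reasoning
  expand : ∀ n t → suc (n + t) * 2 ≡ 2 * suc n + t * 2
  expand = solve-∀
  factor : ∀ n → 2 * suc n + n * suc n ≡ suc n * suc (suc n)
  factor = solve-∀

[_↦_] : ∀ {n} → Fin n → ℕ → Fin n → ℕ
[ zero  ↦ e ] zero    = e
[ zero  ↦ e ] (suc i) = 0
[ suc p ↦ e ] zero    = 0
[ suc p ↦ e ] (suc i) = [ p ↦ e ] i

↦-self : ∀ {n} (p : Fin n) e → [ p ↦ e ] p ≡ e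
↦-self zero    e = refl
↦-self (suc p) e = ↦-self p e

↦-other : ∀ {n} {i p : Fin n} e → i ≢ p → [ p ↦ e ] i ≡ 0
↦-other {i = zero}  {zero}  e i≢p = contradiction refl i≢p
↦-other {i = zero}  {suc p} e i≢p = refl
↦-other {i = suc i} {zero}  e i≢p = refl
↦-other {i = suc i} {suc p} e i≢p = ↦-other e (λ i≡p → i≢p (cong suc i≡p))

∑-↦ : ∀ {n} (p : Fin n) e → ∑[ i < n ] [ p ↦ e ] i ≡ e
∑-↦ {suc n} zero    e = trans (cong (e +_) (sum-replicate-zero n)) (+-identityʳ e)
∑-↦ {suc n} (suc p) e = ∑-↦ p e

*-%-congˡ : ∀ u {v w} d .{{_ : NonZero d}} → v % d ≡ w % d → (u * v) % d ≡ (u * w) % d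
*-%-congˡ u {v} {w} d v≡w = begin
  (u * v) % d                ≡⟨ %-distribˡ-* u v d ⟩
  (u % d * (v % d)) % d      ≡⟨ cong (λ z → (u % d * z) % d) v≡w ⟩
  (u % d * (w % d)) % d      ≡⟨ %-distribˡ-* u w d ⟨
  (u * w) % d                ∎
  where open ≡-Reasoning

∑-%-cong : ∀ {n} d .{{_ : NonZero d}} {F G : Fin n → ℕ} →
  (∀ i → F i % d ≡ G i % d) → (∑[ i < n ] F i) % d ≡ (∑[ i < n ] G i) % d
∑-%-cong {zero}  d F≡G = refl
∑-%-cong {suc n} d {F} {G} F≡G = begin
  (F zero + ∑[ i < n ] F (suc i)) % d                  ≡⟨ %-distribˡ-+ (F zero) _ d ⟩
  (F zero % d + (∑[ i < n ] F (suc i)) % d) % d        ≡⟨ cong₂ (λ u v → (u + v) % d) (F≡G zero) (∑-%-cong d (λ i → F≡G (suc i))) ⟩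
  (G zero % d + (∑[ i < n ] G (suc i)) % d) % d        ≡⟨ %-distribˡ-+ (G zero) _ d ⟨
  (G zero + ∑[ i < n ] G (suc i)) % d                  ∎
  where open ≡-Reasoning

∣∑⇒∣∑-%-cong : ∀ {n} d .{{_ : NonZero d}} {F G : Fin n → ℕ} →
  (∀ i → F i % d ≡ G i % d) → d ∣ ∑[ i < n ] F i → d ∣ ∑[ i < n ] G i
∣∑⇒∣∑-%-cong d {F} {G} F≡G d∣∑F =
  m%n≡0⇒n∣m _ d (trans (sym (∑-%-cong d F≡G)) (n∣m⇒m%n≡0 _ d d∣∑F))

mod≡zeroZ⇒∣ : ∀ s m .{{_ : NonZero m}} → s mod m ≡ zeroZ m → m ∣ s
mod≡zeroZ⇒∣ s m s≡0 = m%n≡0⇒n∣m s m (begin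
  s % m              ≡⟨ toℕ-fromℕ< _ ⟨
  toℕ (s mod m)      ≡⟨ cong toℕ s≡0 ⟩
  toℕ (zeroZ m)      ≡⟨ toℕ-fromℕ< _ ⟩
  0 % m              ≡⟨ m*n%n≡0 0 m ⟩
  0                  ∎)
  where open ≡-Reasoning

weightedTerm : ∀ {m} → (Fin m → ℤ/ m) → Permutation′ m → Fin m → ℕ
weightedTerm a π i = suc (toℕ i) * toℕ (a (π ⟨$⟩ʳ i))

weightedSum≡0⇒∣∑ : ∀ {m} .{{_ : NonZero m}} d .{{_ : NonZero d}} → d ∣ m →
  (a : Fin m → ℤ/ m) (π : Permutation′ m) (F : Fin m → ℕ) →
  (∀ i → weightedTerm a π i % d ≡ F i % d) →
  weightedSum m a π ≡ zeroZ m → d ∣ ∑[ i < m ] F i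
weightedSum≡0⇒∣∑ {m} d d∣m a π F term≡F ws≡0 = ∣∑⇒∣∑-%-cong d term≡F
  (∣-trans d∣m (subst (m ∣_) (sum-map-allFin m (weightedTerm a π)) (mod≡zeroZ⇒∣ _ m ws≡0)))

weightedSum-rearrange : ∀ m .{{_ : NonZero m}} {a g : Fin m → ℤ/ m} → SameMultiset m a g →
  (π : Permutation′ m) → Σ[ τ ∈ Permutation′ m ] weightedSum m a π ≡ weightedSum m g τ
weightedSum-rearrange m {a} {g} (σ , a∘σ≡g) π =
  π ∘ₚ flip σ , cong (λ s → sum s mod m) (map-cong term≡ (allFin m))
  where
  term≡ : ∀ i → weightedTerm a π i ≡ weightedTerm g (π ∘ₚ flip σ) i
  term≡ i = cong (λ t → suc (toℕ i) * toℕ t) (trans (cong a (sym (inverseʳ σ))) (a∘σ≡g (σ ⟨$⟩ˡ (π ⟨$⟩ʳ i))))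

odd-* : ∀ {u v} → Odd u → Odd v → Odd (u * v)
odd-* {u} {v} odd-u odd-v 2∣uv with euclidsLemma u v prime[2] 2∣uv
... | inj₁ 2∣u = odd-u 2∣u
... | inj₂ 2∣v = odd-v 2∣v

even⇒odd-suc : ∀ {m} → Even m → Odd (suc m)
even⇒odd-suc {m} 2∣m 2∣1+m with ∣1⇒≡1 (∣m+n∣m⇒∣n (subst (2 ∣_) (+-comm 1 m) 2∣1+m) 2∣m)
... | ()

2^[1+k]∤2^k*odd : ∀ k {t} → Odd t → ¬ (2 ^ suc k ∣ 2 ^ k * t)
2^[1+k]∤2^k*odd k {t} odd-t 2^[1+k]∣ =
  odd-t (*-cancelˡ-∣ (2 ^ k) {{m^n≢0 2 k}} (subst (_∣ 2 ^ k * t) (*-comm 2 (2 ^ k)) 2^[1+k]∣))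

homogeneous-weightedSum≢0 : ∀ k n m .{{_ : NonZero m}} → Odd n → m ≡ 2 ^ suc k * n →
  (a : Fin m → ℤ/ m) (c : ℕ) → Odd c → (∀ i → mod2^ (toℕ (a i)) (suc k) ≡ mod2^ c (suc k)) →
  (π : Permutation′ m) → weightedSum m a π ≢ zeroZ m
homogeneous-weightedSum≢0 k n m odd-n m≡ a c odd-c a≡c π ws≡0 =
  2^[1+k]∤2^k*odd k (odd-* (odd-* odd-n (even⇒odd-suc 2∣m)) odd-c) 2^[1+k]∣
  where
  instance
    2^[1+k]≢0 : NonZero (2 ^ suc k)
    2^[1+k]≢0 = m^n≢0 2 (suc k)
  2^[1+k]∣m : 2 ^ suc k ∣ m
  2^[1+k]∣m = subst (2 ^ suc k ∣_) (sym m≡) (m∣m*n n)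
  2∣m : 2 ∣ m
  2∣m = ∣-trans (m∣m*n (2 ^ k)) 2^[1+k]∣m
  triangular≡ : triangular m ≡ 2 ^ k * (n * suc m)
  triangular≡ = *-cancelʳ-≡ _ _ 2 (begin
    triangular m * 2                 ≡⟨ triangular*2 m ⟩
    m * suc m                        ≡⟨ cong (_* suc m) m≡ ⟩
    2 * 2 ^ k * n * suc m            ≡⟨ regroup (2 ^ k) n (suc m) ⟩
    2 ^ k * (n * suc m) * 2          ∎)
    where
    open ≡-Reasoning
    regroup : ∀ K n s → 2 * K * n * s ≡ K * (n * s) * 2
    regroup = solve-∀
  ∑≡ : ∑[ i < m ] (suc (toℕ i) * c) ≡ 2 ^ k * (n * suc m * c)
  ∑≡ = trans (sym (*-distribʳ-sum {m} c (λ i → suc (toℕ i))))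
       (trans (cong (_* c) triangular≡) (*-assoc (2 ^ k) (n * suc m) c))
  2^[1+k]∣ : 2 ^ suc k ∣ 2 ^ k * (n * suc m * c)
  2^[1+k]∣ = subst (2 ^ suc k ∣_) ∑≡
    (weightedSum≡0⇒∣∑ (2 ^ suc k) 2^[1+k]∣m a π (λ i → suc (toℕ i) * c)
      (λ i → *-%-congˡ (suc (toℕ i)) (2 ^ suc k) (a≡c (π ⟨$⟩ʳ i))) ws≡0)

coprime⇒∤small* : ∀ {m b d} → Coprime m b → 0 < d → d < m → ¬ (m ∣ d * b)
coprime⇒∤small* {m} {b} {d} m⊥b 0<d d<m m∣d*b =
  <⇒≱ d<m (∣⇒≤ {{>-nonZero 0<d}} (coprime-divisor m⊥b (subst (m ∣_) (*-comm d b) m∣d*b)))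

-- With q = p + 1 + d (or p = q + 1 + d) the sum differs from a multiple of b + c
-- by (1 + d)·b.
∤[1+p]b+[1+q]c : ∀ {m b c p q} → b + c ≡ m → Coprime m b → p < m → q < m → p ≢ q →
  ¬ (m ∣ suc p * b + suc q * c)
∤[1+p]b+[1+q]c {b = b} {c} {p} {q} refl m⊥b p<m q<m p≢q m∣ with <-cmp p q
... | tri≈ _ p≡q _ = p≢q p≡q
... | tri< p<q _ _ with d , refl ← m≤n⇒∃[o]m+o≡n p<q =
  coprime⇒∤small* m⊥b (s≤s z≤n) (≤-<-trans (s≤s (m≤n+m d p)) q<m)
    (∣m+n∣m⇒∣n (subst (b + c ∣_) (identity b c p d) (n∣m*n (suc q))) m∣)
  where
  identity : ∀ b c p d → suc (suc (p + d)) * (b + c) ≡ (suc p * b + suc (suc (p + d)) * c) + suc d * b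
  identity = solve-∀
... | tri> _ _ q<p with d , refl ← m≤n⇒∃[o]m+o≡n q<p =
  coprime⇒∤small* m⊥b (s≤s z≤n) (≤-<-trans (s≤s (m≤n+m d q)) p<m)
    (∣m+n∣m⇒∣n (subst (b + c ∣_) (identity b c q d) m∣) (n∣m*n (suc q)))
  where
  identity : ∀ b c q d → suc (suc (q + d)) * b + suc q * c ≡ suc q * (b + c) + suc d * b
  identity = solve-∀

∣triangular*even : ∀ m {x} → Even x → m ∣ triangular m * x
∣triangular*even m {x} (divides y x≡y*2) = subst (m ∣_) (sym (begin
  triangular m * x             ≡⟨ cong (triangular m *_) x≡y*2 ⟩
  triangular m * (y * 2)       ≡⟨ regroup (triangular m) y ⟩
  y * (triangular m * 2)       ≡⟨ cong (y *_) (triangular*2 m) ⟩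
  y * (m * suc m)              ∎)) (∣n⇒∣m*n y (m∣m*n (suc m)))
  where
  open ≡-Reasoning
  regroup : ∀ t y → t * (y * 2) ≡ y * (t * 2)
  regroup = solve-∀

module _ {m : ℕ} (x b : Fin (suc (suc m))) where

  inhomList-at-m∸2 : ∀ t → toℕ t ≡ m → inhomList (suc (suc m)) x b t ≡ addZ (suc (suc m)) x b
  inhomList-at-m∸2 t t≡m with toℕ t ≟ m | toℕ t ≟ suc m
  ... | yes _ | _ = refl
  ... | no t≢m | _ = contradiction t≡m t≢m

  inhomList-at-m∸1 : ∀ t → toℕ t ≡ suc m → inhomList (suc (suc m)) x b t ≡ subZ (suc (suc m)) x b
  inhomList-at-m∸1 t t≡1+m with toℕ t ≟ m | toℕ t ≟ suc m
  ... | yes t≡m | _ = contradiction (trans (sym t≡1+m) t≡m) 1+n≢n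
  ... | no _ | yes _ = refl
  ... | no _ | no t≢1+m = contradiction t≡1+m t≢1+m

  inhomList-elsewhere : ∀ t → toℕ t ≢ m → toℕ t ≢ suc m → inhomList (suc (suc m)) x b t ≡ x
  inhomList-elsewhere t t≢m t≢1+m with toℕ t ≟ m | toℕ t ≟ suc m
  ... | yes t≡m | _ = contradiction t≡m t≢m
  ... | no _ | yes t≡1+m = contradiction t≡1+m t≢1+m
  ... | no _ | no _ = refl

module InhomogeneousSum {m : ℕ} (x b : Fin (suc (suc m))) (τ : Permutation′ (suc (suc m))) where

  M x′ b′ : ℕ
  M = suc (suc m)
  x′ = toℕ x
  b′ = toℕ b

  slot-a+b slot-a-b : Fin M
  slot-a+b = inject₁ (fromℕ m)
  slot-a-b = fromℕ (suc m)

  toℕ-slot-a+b : toℕ slot-a+b ≡ m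
  toℕ-slot-a+b = trans (toℕ-inject₁ (fromℕ m)) (toℕ-fromℕ m)

  toℕ-slot-a-b : toℕ slot-a-b ≡ suc m
  toℕ-slot-a-b = toℕ-fromℕ (suc m)

  p q : Fin M
  p = τ ⟨$⟩ˡ slot-a+b
  q = τ ⟨$⟩ˡ slot-a-b

  τp≡m : toℕ (τ ⟨$⟩ʳ p) ≡ m
  τp≡m = trans (cong toℕ (inverseʳ τ)) toℕ-slot-a+b

  τq≡1+m : toℕ (τ ⟨$⟩ʳ q) ≡ suc m
  τq≡1+m = trans (cong toℕ (inverseʳ τ)) toℕ-slot-a-b

  τ⁻¹-unique : ∀ {i t} → τ ⟨$⟩ʳ i ≡ t → i ≡ τ ⟨$⟩ˡ t
  τ⁻¹-unique refl = sym (inverseˡ τ)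

  p≢q : p ≢ q
  p≢q p≡q = 1+n≢n (trans (sym τq≡1+m) (trans (cong (λ i → toℕ (τ ⟨$⟩ʳ i)) (sym p≡q)) τp≡m))

  e₁ e₂ : ℕ
  e₁ = suc (toℕ p) * b′
  e₂ = suc (toℕ q) * (M ∸ b′)

  toℕ-mod-% : ∀ s → toℕ {M} (s mod M) % M ≡ s % M
  toℕ-mod-% s = trans {j = s % M % M} (cong (_% M) (toℕ-fromℕ< (m%n<n s M))) (m%n%n≡m%n s M)

  -- h i is the i-th weighted term modulo M, split into i·a and the b-corrections.
  h : Fin M → ℕ
  h i = suc (toℕ i) * x′ + [ p ↦ e₁ ] i + [ q ↦ e₂ ] i

  h-at-p : h p ≡ suc (toℕ p) * (x′ + b′)
  h-at-p = begin
    h p                                 ≡⟨ cong₂ (λ u v → suc (toℕ p) * x′ + u + v) (↦-self p e₁) (↦-other e₂ p≢q) ⟩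
    suc (toℕ p) * x′ + e₁ + 0           ≡⟨ +-identityʳ _ ⟩
    suc (toℕ p) * x′ + e₁               ≡⟨ *-distribˡ-+ (suc (toℕ p)) x′ b′ ⟨
    suc (toℕ p) * (x′ + b′)             ∎
    where open ≡-Reasoning

  h-at-q : h q ≡ suc (toℕ q) * (x′ + (M ∸ b′))
  h-at-q = begin
    h q                                 ≡⟨ cong (λ u → suc (toℕ q) * x′ + u + [ q ↦ e₂ ] q) (↦-other e₁ (p≢q ∘ sym)) ⟩
    suc (toℕ q) * x′ + 0 + [ q ↦ e₂ ] q ≡⟨ cong₂ _+_ (+-identityʳ _) (↦-self q e₂) ⟩
    suc (toℕ q) * x′ + e₂               ≡⟨ *-distribˡ-+ (suc (toℕ q)) x′ (M ∸ b′) ⟨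
    suc (toℕ q) * (x′ + (M ∸ b′))       ∎
    where open ≡-Reasoning

  h-elsewhere : ∀ {i} → i ≢ p → i ≢ q → h i ≡ suc (toℕ i) * x′
  h-elsewhere {i} i≢p i≢q = begin
    h i                                 ≡⟨ cong₂ (λ u v → suc (toℕ i) * x′ + u + v) (↦-other e₁ i≢p) (↦-other e₂ i≢q) ⟩
    suc (toℕ i) * x′ + 0 + 0            ≡⟨ cong (_+ 0) (+-identityʳ _) ⟩
    suc (toℕ i) * x′ + 0                ≡⟨ +-identityʳ _ ⟩
    suc (toℕ i) * x′                    ∎
    where open ≡-Reasoning

  term-% : ∀ i → weightedTerm (inhomList M x b) τ i % M ≡ h i % M
  term-% i with i Fin.≟ p | i Fin.≟ q
  ... | yes refl | _ = begin
    suc (toℕ p) * toℕ (inhomList M x b (τ ⟨$⟩ʳ p)) % M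
      ≡⟨ cong (λ t → suc (toℕ p) * toℕ t % M) (inhomList-at-m∸2 x b _ τp≡m) ⟩
    suc (toℕ p) * toℕ (addZ M x b) % M
      ≡⟨ *-%-congˡ (suc (toℕ p)) {toℕ (addZ M x b)} {x′ + b′} M (toℕ-mod-% (x′ + b′)) ⟩
    suc (toℕ p) * (x′ + b′) % M
      ≡⟨ cong (_% M) h-at-p ⟨
    h p % M ∎
    where open ≡-Reasoning
  ... | no _ | yes refl = begin
    suc (toℕ q) * toℕ (inhomList M x b (τ ⟨$⟩ʳ q)) % M
      ≡⟨ cong (λ t → suc (toℕ q) * toℕ t % M) (inhomList-at-m∸1 x b _ τq≡1+m) ⟩
    suc (toℕ q) * toℕ (subZ M x b) % M
      ≡⟨ *-%-congˡ (suc (toℕ q)) {toℕ (subZ M x b)} {x′ + (M ∸ b′)} M (toℕ-mod-% (x′ + (M ∸ b′))) ⟩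
    suc (toℕ q) * (x′ + (M ∸ b′)) % M
      ≡⟨ cong (_% M) h-at-q ⟨
    h q % M ∎
    where open ≡-Reasoning
  ... | no i≢p | no i≢q = cong (_% M) (trans (cong (λ t → suc (toℕ i) * toℕ t) (inhomList-elsewhere x b _ τi≢m τi≢1+m))
                                             (sym (h-elsewhere i≢p i≢q)))
    where
    τi≢m : toℕ (τ ⟨$⟩ʳ i) ≢ m
    τi≢m τi≡m = i≢p (τ⁻¹-unique (toℕ-injective (trans τi≡m (sym toℕ-slot-a+b))))
    τi≢1+m : toℕ (τ ⟨$⟩ʳ i) ≢ suc m
    τi≢1+m τi≡1+m = i≢q (τ⁻¹-unique (toℕ-injective (trans τi≡1+m (sym toℕ-slot-a-b))))

  ∑h : ∑[ i < M ] h i ≡ triangular M * x′ + e₁ + e₂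
  ∑h = begin
    ∑[ i < M ] h i
      ≡⟨ ∑-distrib-+ {M} (λ i → suc (toℕ i) * x′ + [ p ↦ e₁ ] i) [ q ↦ e₂ ] ⟩
    ∑[ i < M ] (suc (toℕ i) * x′ + [ p ↦ e₁ ] i) + ∑[ i < M ] [ q ↦ e₂ ] i
      ≡⟨ cong₂ _+_ (∑-distrib-+ {M} (λ i → suc (toℕ i) * x′) [ p ↦ e₁ ]) (∑-↦ q e₂) ⟩
    ∑[ i < M ] (suc (toℕ i) * x′) + ∑[ i < M ] [ p ↦ e₁ ] i + e₂
      ≡⟨ cong₂ (λ u v → u + v + e₂) (*-distribʳ-sum {M} x′ (λ i → suc (toℕ i))) (sym (∑-↦ p e₁)) ⟨
    triangular M * x′ + e₁ + e₂ ∎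
    where open ≡-Reasoning

  weightedSum≢0 : Even x′ → gcd b′ M ≡ 1 → weightedSum M (inhomList M x b) τ ≢ zeroZ M
  weightedSum≢0 x-even gcd≡1 ws≡0 =
    ∤[1+p]b+[1+q]c {b = b′} {c = M ∸ b′} (m+[n∸m]≡n (<⇒≤ (toℕ<n b))) (Coprimality.sym (gcd≡1⇒coprime gcd≡1))
      (toℕ<n p) (toℕ<n q) (p≢q ∘ toℕ-injective) M∣e₁+e₂
    where
    M∣∑h : M ∣ triangular M * x′ + e₁ + e₂
    M∣∑h = subst (M ∣_) ∑h (weightedSum≡0⇒∣∑ M ∣-refl (inhomList M x b) τ h term-% ws≡0)
    M∣e₁+e₂ : M ∣ e₁ + e₂
    M∣e₁+e₂ = ∣m+n∣m⇒∣n (subst (M ∣_) (+-assoc (triangular M * x′) e₁ e₂) M∣∑h) (∣triangular*even M x-even)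

inhomogeneous-weightedSum≢0 : ∀ m .{{_ : NonZero m}} → 2 ≤ m → (x b : ℤ/ m) → Even (toℕ x) →
  gcd (toℕ b) m ≡ 1 → (τ : Permutation′ m) → weightedSum m (inhomList m x b) τ ≢ zeroZ m
inhomogeneous-weightedSum≢0 (suc (suc m)) (s≤s (s≤s z≤n)) x b x-even gcd≡1 τ =
  InhomogeneousSum.weightedSum≢0 x b τ x-even gcd≡1

proposition1p4 : (k n m : ℕ) .{{_ : NonZero m}} → 1 ≤ k → Odd n → m ≡ 2 ^ k * n →
    (a : Fin m → ℤ/ m) →
    ((c : ℕ) → Odd c → (∀ i → mod2^ (toℕ (a i)) k ≡ mod2^ c k) →
      (π : Permutation′ m) → ¬ (weightedSum m a π ≡ zeroZ m))
    ×
    ((x b : ℤ/ m) → Even (toℕ x) → gcd (toℕ b) m ≡ 1 → SameMultiset m a (inhomList m x b) →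
      (π : Permutation′ m) → ¬ (weightedSum m a π ≡ zeroZ m))
proposition1p4 (suc k) n m (s≤s z≤n) odd-n m≡ a =
  homogeneous-weightedSum≢0 k n m odd-n m≡ a ,
  λ x b x-even gcd≡1 a~inhom π ws≡0 →
    let τ , ws≡ = weightedSum-rearrange m {a} a~inhom π in
    inhomogeneous-weightedSum≢0 m 2≤m x b x-even gcd≡1 τ (trans (sym ws≡) ws≡0)
  where
  2≤m : 2 ≤ m
  2≤m = ∣⇒≤ (subst (2 ∣_) (sym m≡) (∣m⇒∣m*n n (m∣m*n (2 ^ k))))
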